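{- Let $\ast_1,\dots,\ast_m$ be binary operations on finite sets $\mathcal{X}_1,\dots,\mathcal{X}_m$, $\mathcal{X}=\mathcal{X}_1\times\dots\times\mathcal{X}_m$ and $\ast=\ast_1\otimes\dots\otimes\ast_m$. Then: (1) $\ast$ is uniformity preserving if and only if $\ast_1,\dots,\ast_m$ are uniformity preserving. (2) If $\ast$ is irreducible then $\ast_1,\dots,\ast_m$ are irreducible; the converse does not hold in general (there exist irreducible operations $\ast_1,\ast_2$ such that $\ast_1\otimes\ast_2$ is not irreducible). (3) $\ast$ is ergodic if and only if $\ast_1,\dots,\ast_m$ are ergodic, and in that case $\mathrm{con}(\ast)=\max\{\mathrm{con}(\ast_1),\dots,\mathrm{con}(\ast_m)\}$.
   Context: The product $\ast_1\otimes\dots\otimes\ast_m$ is the componentwise operation $(x_1,\dots,x_m)\ast(x_1',\dots,x_m')=(x_1\ast_1x_1',\dots,x_m\ast_mx_m')$. A binary operation $\ast$ on finite $\mathcal{Y}$ is uniformity preserving if each map $y\mapsto y\ast b$ is bijective. $a$ is $\ast$-connectable to $b$ in $l$ steps if there are $x_0,\dots,x_{l-1}$ with $(\cdots((a\ast x_0)\ast x_1)\cdots)\ast x_{l-1}=b$. A uniformity preserving $\ast$ is irreducible if each element is connectable to each element in some number $l>0$ of steps; ergodic if there is a single $l>0$ such that all elements are connectable to each other in $l$ steps; $\mathrm{con}(\ast)$ is the least such $l$. -}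

module Defs where

open import Data.Nat using (ℕ; zero; suc; _<_; _⊔_)
open import Data.Fin using (Fin; zero; suc)
open import Data.Vec using (Vec; []; _∷_)
open import Data.Product using (Σ; ∃; _×_; _,_)
open import Data.Unit using (⊤; tt)
open import Relation.Nullary using (¬_)
open import Relation.Binary.PropositionalEquality using (_≡_)
open import Function.Definitions using (Bijective)

Op : Set → Set
Op A = A → A → A

UniformityPreserving : {A : Set} → Op A → Set
UniformityPreserving {A} _∗_ = ∀ (b : A) → Bijective _≡_ _≡_ (λ y → y ∗ b)

iterOp : {A : Set} {l : ℕ} → Op A → A → Vec A l → A
iterOp _∗_ a [] = a
iterOp _∗_ a (x ∷ xs) = iterOp _∗_ (a ∗ x) xs

Connectable : {A : Set} → Op A → A → A → ℕ → Set
Connectable {A} _∗_ a b l = Σ (Vec A l) λ xs → iterOp _∗_ a xs ≡ b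

AllConnectable : {A : Set} → Op A → ℕ → Set
AllConnectable {A} _∗_ l = ∀ (a b : A) → Connectable _∗_ a b l

Irreducible : {A : Set} → Op A → Set
Irreducible {A} _∗_ =
  UniformityPreserving _∗_ × (∀ (a b : A) → ∃ λ l → 0 < l × Connectable _∗_ a b l)

Ergodic : {A : Set} → Op A → Set
Ergodic _∗_ = UniformityPreserving _∗_ × (∃ λ l → 0 < l × AllConnectable _∗_ l)

IsCon : {A : Set} → Op A → ℕ → Set
IsCon _∗_ c =
  0 < c × AllConnectable _∗_ c × (∀ l → 0 < l → l < c → ¬ AllConnectable _∗_ l)

Prod : (m : ℕ) → (Fin m → ℕ) → Set
Prod zero n = ⊤
Prod (suc m) n = Fin (n zero) × Prod m (λ i → n (suc i))

⊗ : (m : ℕ) (n : Fin m → ℕ) → ((i : Fin m) → Op (Fin (n i))) → Op (Prod m n)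
⊗ zero n op _ _ = tt
⊗ (suc m) n op (x , xs) (y , ys) =
  op zero x y , ⊗ m (λ i → n (suc i)) (λ i → op (suc i)) xs ys

maxF : (m : ℕ) → (Fin m → ℕ) → ℕ
maxF zero c = 0
maxF (suc m) c = c zero ⊔ maxF m (λ i → c (suc i))

-- Projection to a coordinate commutes with ⊗ and hence with iterated products, so a
-- sequence of l steps in the product is the same thing as a tuple of sequences of l steps
-- in the factors. Bijectivity of translations and connectability in l steps therefore
-- transfer coordinatewise, provided all factors use the same l. For ergodic factors this
-- is possible because connectability of all pairs in l steps persists to l + 1 steps (make
-- an arbitrary first step), so all factors connect in max con(∗ᵢ) steps, and no fewer
-- suffice in the product. Irreducible factors need not share a connecting length, which
-- the counterexample exploits.
module Submission where

open import Defs
open import Data.Nat using (ℕ; zero; suc; _<_; _≤_; _≤′_; ≤′-refl; ≤′-step; s≤s; z≤n)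
open import Data.Nat.Properties using (≤-trans; <-≤-trans; m≤m⊔n; m≤n⊔m; ⊔-sel; ≤⇒≤′)
open import Data.Fin using (Fin; zero; suc; fromℕ<)
open import Data.Vec using (Vec; []; _∷_; map; head; tail)
open import Data.Product using (Σ; ∃; _×_; _,_; proj₁; proj₂)
open import Data.Sum using (inj₁; inj₂)
open import Data.Unit using (tt)
open import Relation.Nullary using (¬_)
open import Relation.Binary.PropositionalEquality
  using (_≡_; refl; sym; trans; cong; cong₂; subst; module ≡-Reasoning)
open import Function.Bundles using (_⇔_; mk⇔)

open ≡-Reasoning

proj : ∀ m {n : Fin m → ℕ} (i : Fin m) → Prod m n → Fin (n i)
proj (suc m) zero    (x , _)  = x
proj (suc m) (suc i) (_ , xs) = proj m i xs

tabulate : ∀ m {n : Fin m → ℕ} → ((i : Fin m) → Fin (n i)) → Prod m n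
tabulate zero    f = tt
tabulate (suc m) f = f zero , tabulate m (λ i → f (suc i))

update : ∀ m {n : Fin m → ℕ} (i : Fin m) → Fin (n i) → Prod m n → Prod m n
update (suc m) zero    a (_ , zs) = a , zs
update (suc m) (suc i) a (z , zs) = z , update m i a zs

proj-tabulate : ∀ m {n : Fin m → ℕ} (f : (i : Fin m) → Fin (n i)) i →
                proj m i (tabulate m f) ≡ f i
proj-tabulate (suc m) f zero    = refl
proj-tabulate (suc m) f (suc i) = proj-tabulate m (λ i → f (suc i)) i

proj-update : ∀ m {n : Fin m → ℕ} i a (z : Prod m n) → proj m i (update m i a z) ≡ a
proj-update (suc m) zero    a z = refl
proj-update (suc m) (suc i) a z = proj-update m i a (proj₂ z)

Prod-ext : ∀ m {n : Fin m → ℕ} {x y : Prod m n} → (∀ i → proj m i x ≡ proj m i y) → x ≡ y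
Prod-ext zero    h = refl
Prod-ext (suc m) h = cong₂ _,_ (h zero) (Prod-ext m (λ i → h (suc i)))

module _ (m : ℕ) {n : Fin m → ℕ} (op : (i : Fin m) → Op (Fin (n i))) where

  private
    _⊛_ : Op (Prod m n)
    _⊛_ = ⊗ m n op

  proj-⊗ : ∀ i x y → proj m i (x ⊛ y) ≡ op i (proj m i x) (proj m i y)
  proj-⊗ = go m op
    where
    go : ∀ m {n : Fin m → ℕ} (op : (i : Fin m) → Op (Fin (n i))) i x y →
         proj m i (⊗ m n op x y) ≡ op i (proj m i x) (proj m i y)
    go (suc m) op zero    x y = refl
    go (suc m) op (suc i) x y = go m (λ i → op (suc i)) i (proj₂ x) (proj₂ y)

  update-⊗ : ∀ i a b z w → update m i a z ⊛ update m i b w ≡ update m i (op i a b) (z ⊛ w)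
  update-⊗ = go m op
    where
    go : ∀ m {n : Fin m → ℕ} (op : (i : Fin m) → Op (Fin (n i))) i a b z w →
         ⊗ m n op (update m i a z) (update m i b w) ≡ update m i (op i a b) (⊗ m n op z w)
    go (suc m) op zero    a b z w = refl
    go (suc m) op (suc i) a b z w =
      cong (op zero (proj₁ z) (proj₁ w) ,_) (go m (λ i → op (suc i)) i a b (proj₂ z) (proj₂ w))

  proj-iterOp : ∀ i {l} a (xs : Vec (Prod m n) l) →
                proj m i (iterOp _⊛_ a xs) ≡ iterOp (op i) (proj m i a) (map (proj m i) xs)
  proj-iterOp i a []       = refl
  proj-iterOp i a (x ∷ xs) = begin
    proj m i (iterOp _⊛_ (a ⊛ x) xs)                               ≡⟨ proj-iterOp i (a ⊛ x) xs ⟩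
    iterOp (op i) (proj m i (a ⊛ x)) (map (proj m i) xs)           ≡⟨ cong (λ t → iterOp (op i) t (map (proj m i) xs)) (proj-⊗ i a x) ⟩
    iterOp (op i) (op i (proj m i a) (proj m i x)) (map (proj m i) xs) ∎

  zipSteps : ∀ {l} → ((i : Fin m) → Vec (Fin (n i)) l) → Vec (Prod m n) l
  zipSteps {zero}  v = []
  zipSteps {suc l} v = tabulate m (λ i → head (v i)) ∷ zipSteps (λ i → tail (v i))

  proj-iterOp-zipSteps : ∀ i {l} a (v : (i : Fin m) → Vec (Fin (n i)) l) →
                         proj m i (iterOp _⊛_ a (zipSteps v)) ≡ iterOp (op i) (proj m i a) (v i)
  proj-iterOp-zipSteps i {zero} a v with v i
  ... | [] = refl
  proj-iterOp-zipSteps i {suc l} a v with v i in eq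
  ... | x ∷ xs = begin
    proj m i (iterOp _⊛_ (a ⊛ step) (zipSteps (λ j → tail (v j))))   ≡⟨ proj-iterOp-zipSteps i (a ⊛ step) (λ j → tail (v j)) ⟩
    iterOp (op i) (proj m i (a ⊛ step)) (tail (v i))                 ≡⟨ cong₂ (iterOp (op i)) proj-a⊛step (cong tail eq) ⟩
    iterOp (op i) (op i (proj m i a) x) xs                           ∎
    where
    step = tabulate m (λ j → head (v j))
    proj-a⊛step : proj m i (a ⊛ step) ≡ op i (proj m i a) x
    proj-a⊛step = begin
      proj m i (a ⊛ step)                    ≡⟨ proj-⊗ i a step ⟩
      op i (proj m i a) (proj m i step)      ≡⟨ cong (op i (proj m i a)) (proj-tabulate m _ i) ⟩
      op i (proj m i a) (head (v i))         ≡⟨ cong (λ t → op i (proj m i a) (head t)) eq ⟩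
      op i (proj m i a) x                    ∎

module _ (m : ℕ) {n : Fin m → ℕ} (op : (i : Fin m) → Op (Fin (n i))) where

  private
    _⊛_ : Op (Prod m n)
    _⊛_ = ⊗ m n op

  uniformityPreserving-⊗ : (∀ i → UniformityPreserving (op i)) → UniformityPreserving _⊛_
  uniformityPreserving-⊗ U b = injective , surjective
    where
    injective : ∀ {x y} → x ⊛ b ≡ y ⊛ b → x ≡ y
    injective {x} {y} e = Prod-ext m λ i → proj₁ (U i (proj m i b)) (begin
      op i (proj m i x) (proj m i b)   ≡⟨ sym (proj-⊗ m op i x b) ⟩
      proj m i (x ⊛ b)                 ≡⟨ cong (proj m i) e ⟩
      proj m i (y ⊛ b)                 ≡⟨ proj-⊗ m op i y b ⟩
      op i (proj m i y) (proj m i b)   ∎)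
    surjective : ∀ y → ∃ λ x → ∀ {z} → z ≡ x → z ⊛ b ≡ y
    surjective y = tabulate m preimage , λ { refl → Prod-ext m λ i → begin
        proj m i (tabulate m preimage ⊛ b)                     ≡⟨ proj-⊗ m op i _ b ⟩
        op i (proj m i (tabulate m preimage)) (proj m i b)     ≡⟨ cong (λ t → op i t (proj m i b)) (proj-tabulate m preimage i) ⟩
        op i (preimage i) (proj m i b)                         ≡⟨ proj₂ (proj₂ (U i (proj m i b)) (proj m i y)) refl ⟩
        proj m i y                                             ∎ }
      where
      preimage : (i : Fin m) → Fin (n i)
      preimage i = proj₁ (proj₂ (U i (proj m i b)) (proj m i y))

  -- A factor embeds into the product only through a base point; with an empty factor the
  -- product is empty and says nothing about the other factors.
  module _ (base : Prod m n) where

    ⊗-uniformityPreserving : UniformityPreserving _⊛_ → ∀ i → UniformityPreserving (op i)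
    ⊗-uniformityPreserving U i b = injective , surjective
      where
      B = update m i b base
      injective : ∀ {x y} → op i x b ≡ op i y b → x ≡ y
      injective {x} {y} e = begin
        x                                 ≡⟨ sym (proj-update m i x base) ⟩
        proj m i (update m i x base)      ≡⟨ cong (proj m i) (proj₁ (U B) translates-equal) ⟩
        proj m i (update m i y base)      ≡⟨ proj-update m i y base ⟩
        y                                 ∎
        where
        translates-equal : update m i x base ⊛ B ≡ update m i y base ⊛ B
        translates-equal = begin
          update m i x base ⊛ B                    ≡⟨ update-⊗ m op i x b base base ⟩
          update m i (op i x b) (base ⊛ base)      ≡⟨ cong (λ t → update m i t (base ⊛ base)) e ⟩
          update m i (op i y b) (base ⊛ base)      ≡⟨ sym (update-⊗ m op i y b base base) ⟩
          update m i y base ⊛ B                    ∎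
      surjective : ∀ y → ∃ λ x → ∀ {z} → z ≡ x → op i z b ≡ y
      surjective y with proj₂ (U B) (update m i y base)
      ... | X , X⊛B≡ = proj m i X , λ { refl → begin
        op i (proj m i X) b                ≡⟨ cong (op i (proj m i X)) (sym (proj-update m i b base)) ⟩
        op i (proj m i X) (proj m i B)     ≡⟨ sym (proj-⊗ m op i X B) ⟩
        proj m i (X ⊛ B)                   ≡⟨ cong (proj m i) (X⊛B≡ refl) ⟩
        proj m i (update m i y base)       ≡⟨ proj-update m i y base ⟩
        y                                  ∎ }

    ⊗-connectable : ∀ i a b {l} →
                    Connectable _⊛_ (update m i a base) (update m i b base) l → Connectable (op i) a b l
    ⊗-connectable i a b (xs , e) = map (proj m i) xs , (begin
      iterOp (op i) a (map (proj m i) xs)                               ≡⟨ cong (λ t → iterOp (op i) t (map (proj m i) xs)) (sym (proj-update m i a base)) ⟩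
      iterOp (op i) (proj m i (update m i a base)) (map (proj m i) xs)  ≡⟨ sym (proj-iterOp m op i _ xs) ⟩
      proj m i (iterOp _⊛_ (update m i a base) xs)                      ≡⟨ cong (proj m i) e ⟩
      proj m i (update m i b base)                                      ≡⟨ proj-update m i b base ⟩
      b                                                                 ∎)

    ⊗-irreducible : Irreducible _⊛_ → ∀ i → Irreducible (op i)
    ⊗-irreducible (U , C) i = ⊗-uniformityPreserving U i , λ a b →
      let l , l>0 , c = C (update m i a base) (update m i b base) in l , l>0 , ⊗-connectable i a b c

    ⊗-allConnectable : ∀ {l} → AllConnectable _⊛_ l → ∀ i → AllConnectable (op i) l
    ⊗-allConnectable A i a b = ⊗-connectable i a b (A _ _)

    ⊗-ergodic : Ergodic _⊛_ → ∀ i → Ergodic (op i)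
    ⊗-ergodic (U , l , l>0 , A) i = ⊗-uniformityPreserving U i , l , l>0 , ⊗-allConnectable A i

  allConnectable-⊗ : ∀ {l} → (∀ i → AllConnectable (op i) l) → AllConnectable _⊛_ l
  allConnectable-⊗ A a b = zipSteps m op steps , Prod-ext m λ i →
      trans (proj-iterOp-zipSteps m op i a steps) (proj₂ (A i (proj m i a) (proj m i b)))
    where
    steps : (i : Fin m) → Vec (Fin (n i)) _
    steps i = proj₁ (A i (proj m i a) (proj m i b))

allConnectable-suc : ∀ {A : Set} (f : Op A) → A → ∀ {l} → AllConnectable f l → AllConnectable f (suc l)
allConnectable-suc f e h a b = e ∷ proj₁ (h (f a e) b) , proj₂ (h (f a e) b)

allConnectable-mono : ∀ {A : Set} (f : Op A) → A → ∀ {l l′} → l ≤ l′ → AllConnectable f l → AllConnectable f l′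
allConnectable-mono f e l≤l′ = go (≤⇒≤′ l≤l′)
  where
  go : ∀ {l l′} → l ≤′ l′ → AllConnectable f l → AllConnectable f l′
  go ≤′-refl         h = h
  go (≤′-step l≤′l′) h = allConnectable-suc f e (go l≤′l′ h)

≤-maxF : ∀ m (c : Fin m → ℕ) i → c i ≤ maxF m c
≤-maxF (suc m) c zero    = m≤m⊔n _ _
≤-maxF (suc m) c (suc i) = ≤-trans (≤-maxF m (λ i → c (suc i)) i) (m≤n⊔m _ _)

<-maxF⇒<-some : ∀ m (c : Fin m → ℕ) {l} → l < maxF m c → ∃ λ i → l < c i
<-maxF⇒<-some (suc m) c {l} l<max with ⊔-sel (c zero) (maxF m (λ i → c (suc i)))
... | inj₁ max≡c₀ = zero , subst (l <_) max≡c₀ l<max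
... | inj₂ max≡rest with <-maxF⇒<-some m (λ i → c (suc i)) (subst (l <_) max≡rest l<max)
...   | i , l<cᵢ = suc i , l<cᵢ

allConnectable-⊗-maxF : ∀ m {n : Fin m → ℕ} (op : (i : Fin m) → Op (Fin (n i))) →
                        (∀ i → Fin (n i)) → (c : Fin m → ℕ) →
                        (∀ i → AllConnectable (op i) (c i)) → AllConnectable (⊗ m n op) (maxF m c)
allConnectable-⊗-maxF m op elem c A =
  allConnectable-⊗ m op λ i → allConnectable-mono (op i) (elem i) (≤-maxF m c i) (A i)

module _ (m : ℕ) {n : Fin m → ℕ} (op : (i : Fin m) → Op (Fin (n i)))
         (i₀ : Fin m) (elem : ∀ i → Fin (n i)) where

  ergodic-⊗ : (∀ i → Ergodic (op i)) → Ergodic (⊗ m n op)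
  ergodic-⊗ E =
      uniformityPreserving-⊗ m op (λ i → proj₁ (E i))
    , maxF m length , <-≤-trans (proj₁ (proj₂ (proj₂ (E i₀)))) (≤-maxF m length i₀)
    , allConnectable-⊗-maxF m op elem length (λ i → proj₂ (proj₂ (proj₂ (E i))))
    where
    length : Fin m → ℕ
    length i = proj₁ (proj₂ (E i))

  isCon-⊗ : (c : Fin m → ℕ) → (∀ i → IsCon (op i) (c i)) → IsCon (⊗ m n op) (maxF m c)
  isCon-⊗ c C =
      <-≤-trans (proj₁ (C i₀)) (≤-maxF m c i₀)
    , allConnectable-⊗-maxF m op elem c (λ i → proj₁ (proj₂ (C i)))
    , λ l l>0 l<max A → let i , l<cᵢ = <-maxF⇒<-some m c l<max
                        in proj₂ (proj₂ (C i)) l l>0 l<cᵢ (⊗-allConnectable m op (tabulate m elem) A i)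

-- Counterexample: x ∗ y = x + 1 on Fin 2; in its square both coordinates flip together,
-- so the diagonal is closed and (0, 0) never reaches (0, 1).

flip : Fin 2 → Fin 2
flip zero       = suc zero
flip (suc zero) = zero

_∗flip_ : Op (Fin 2)
x ∗flip _ = flip x

flip-involutive : ∀ x → flip (flip x) ≡ x
flip-involutive zero       = refl
flip-involutive (suc zero) = refl

uniformityPreserving-flip : UniformityPreserving _∗flip_
uniformityPreserving-flip b = injective , surjective
  where
  injective : ∀ {x y} → flip x ≡ flip y → x ≡ y
  injective {x} {y} e = trans (sym (flip-involutive x)) (trans (cong flip e) (flip-involutive y))
  surjective : ∀ y → ∃ λ x → ∀ {z} → z ≡ x → flip z ≡ y
  surjective y = flip y , λ { refl → flip-involutive y }

irreducible-flip : Irreducible _∗flip_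
irreducible-flip = uniformityPreserving-flip , connect
  where
  connect : ∀ a b → ∃ λ l → 0 < l × Connectable _∗flip_ a b l
  connect zero       zero       = 2 , s≤s z≤n , (zero ∷ zero ∷ []) , refl
  connect zero       (suc zero) = 1 , s≤s z≤n , (zero ∷ []) , refl
  connect (suc zero) zero       = 1 , s≤s z≤n , (zero ∷ []) , refl
  connect (suc zero) (suc zero) = 2 , s≤s z≤n , (zero ∷ zero ∷ []) , refl

two : Fin 2 → ℕ
two _ = 2

flip² : Op (Prod 2 two)
flip² = ⊗ 2 two (λ _ → _∗flip_)

iterOp-flip²-diagonal : ∀ {l} x (xs : Vec (Prod 2 two) l) →
                        ∃ λ y → iterOp flip² (x , x , tt) xs ≡ (y , y , tt)
iterOp-flip²-diagonal x []       = x , refl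
iterOp-flip²-diagonal x (_ ∷ xs) = iterOp-flip²-diagonal (flip x) xs

¬irreducible-flip² : ¬ Irreducible flip²
¬irreducible-flip² (_ , C) with C (zero , zero , tt) (zero , suc zero , tt)
... | _ , _ , xs , reaches with iterOp-flip²-diagonal zero xs
...   | zero       , diagonal with () ← trans (sym diagonal) reaches
...   | suc zero   , diagonal with () ← trans (sym diagonal) reaches

⊗-transfer : (m : ℕ) → 1 ≤ m → (n : Fin m → ℕ) → (∀ i → 0 < n i) → (op : (i : Fin m) → Op (Fin (n i))) →
  (UniformityPreserving (⊗ m n op) ⇔ (∀ i → UniformityPreserving (op i)))
  × (Irreducible (⊗ m n op) → ∀ i → Irreducible (op i))
  × (Ergodic (⊗ m n op) ⇔ (∀ i → Ergodic (op i)))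
  × ((c : Fin m → ℕ) → (∀ i → IsCon (op i) (c i)) → IsCon (⊗ m n op) (maxF m c))
⊗-transfer m m≥1 n n>0 op =
    mk⇔ (⊗-uniformityPreserving m op base) (uniformityPreserving-⊗ m op)
  , ⊗-irreducible m op base
  , mk⇔ (⊗-ergodic m op base) (ergodic-⊗ m op i₀ elem)
  , isCon-⊗ m op i₀ elem
  where
  i₀ : Fin m
  i₀ = fromℕ< m≥1
  elem : ∀ i → Fin (n i)
  elem i = fromℕ< (n>0 i)
  base : Prod m n
  base = tabulate m elem

mainTheorem13 : ((m : ℕ) → 1 ≤ m → (n : Fin m → ℕ) → (∀ i → 0 < n i) →
    (op : (i : Fin m) → Op (Fin (n i))) →
    (UniformityPreserving (⊗ m n op) ⇔ (∀ i → UniformityPreserving (op i)))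
    × (Irreducible (⊗ m n op) → ∀ i → Irreducible (op i))
    × (Ergodic (⊗ m n op) ⇔ (∀ i → Ergodic (op i)))
    × ((c : Fin m → ℕ) → (∀ i → IsCon (op i) (c i)) → IsCon (⊗ m n op) (maxF m c)))
    × (Σ (Fin 2 → ℕ) λ n → (∀ i → 0 < n i) × Σ ((i : Fin 2) → Op (Fin (n i))) λ op →
    (∀ i → Irreducible (op i)) × ¬ Irreducible (⊗ 2 n op))
mainTheorem13 = ⊗-transfer , two , (λ _ → s≤s z≤n) , (λ _ → _∗flip_) , (λ _ → irreducible-flip) , ¬irreducible-flip²
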